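{- Let $q\ge 2$ and $n\ge 1$ be integers, and let $S$ be an orientable sequence of order $n$ over $\mathbb{Z}_q$ with period $m$ such that $w_q(S)$ has additive order $q$ in $\mathbb{Z}_q$. Let $t>0$ be the length of a maximal run of $0$ in $S$. Then $D^{ -1}(S)$ consists of $q$ shifts of one sequence, each element of $D^{ -1}(S)$ has period $qm$, and each element of $D^{ -1}(S)$ contains a maximal run $a^{t+1}$ for every $a\in\mathbb{Z}_q$.
   Context: Sequences are periodic over $\mathbb{Z}_q$; period means least period. For $S=(s_i)$ of period $m$, $\mathbf{s}_n(i)=(s_i,\dots,s_{i+n-1})$ and $w_q(S)=\sum_{i=0}^{m-1}s_i\bmod q$. For $\mathbf{u}=(u_0,\dots,u_{n-1})$, $\mathbf{u}^R=(u_{n-1},\dots,u_0)$. $S$ is an orientable sequence of order $n$ if $\mathbf{s}_n(i)=\mathbf{s}_n(j)$ implies $i\equiv j\pmod m$ and $\mathbf{s}_n(i)\ne\mathbf{s}_n(j)^R$ for all $i,j$. $a^t$ denotes $t$ consecutive entries equal to $a$; a run $a^t$ in $S$ is maximal if every string $a^{t'}$ of consecutive entries of $S$ has $t'\le t$. $D$ maps $(t_i)$ to $(t_{i+1}-t_i)$, and $D^{ -1}(S)$ is the set of all periodic sequences $T$ with $D(T)=S$. -}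

module Defs where

open import Data.Nat using (ℕ; zero; suc; _+_; _*_; _≤_; _<_)
open import Data.Fin using (Fin; toℕ)
open import Data.Vec using (Vec; tabulate; reverse)
open import Data.Product using (Σ; ∃; ∃-syntax; _×_)
open import Relation.Binary.PropositionalEquality using (_≡_; _≢_)

-- A (periodic) sequence over Z_q, indexed by ℕ; Z_q is represented by Fin q
-- (residues 0..q-1). Periodicity is imposed separately via IsPeriod / HasPeriod.
Seq : ℕ → Set
Seq q = ℕ → Fin q

infix 4 _≡_[mod_]
_≡_[mod_] : ℕ → ℕ → ℕ → Set
i ≡ j [mod m ] = ∃[ a ] ∃[ b ] (i + a * m ≡ j + b * m)

IsPeriod : ∀ {q} → Seq q → ℕ → Set
IsPeriod s p = (0 < p) × (∀ i → s (i + p) ≡ s i)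

Periodic : ∀ {q} → Seq q → Set
Periodic s = ∃[ p ] IsPeriod s p

HasPeriod : ∀ {q} → Seq q → ℕ → Set
HasPeriod s m = IsPeriod s m × (∀ p → IsPeriod s p → m ≤ p)

window : ∀ {q} → Seq q → (n : ℕ) → ℕ → Vec (Fin q) n
window s n i = tabulate (λ k → s (i + toℕ k))

Orientable : ∀ {q} → Seq q → (m n : ℕ) → Set
Orientable s m n =
  (∀ i j → window s n i ≡ window s n j → i ≡ j [mod m ]) ×
  (∀ i j → window s n i ≢ reverse (window s n j))

sumTo : (ℕ → ℕ) → ℕ → ℕ
sumTo f zero    = 0
sumTo f (suc m) = sumTo f m + f m

-- w_q(S) as a natural number representative (to be read mod q)
weight : ∀ {q} → Seq q → ℕ → ℕ
weight s m = sumTo (λ i → toℕ (s i)) m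

AddOrder : (q x k : ℕ) → Set
AddOrder q x k = (0 < k) × (k * x ≡ 0 [mod q ]) ×
                 (∀ j → 0 < j → j * x ≡ 0 [mod q ] → k ≤ j)

RunAt : ∀ {q} → Seq q → Fin q → ℕ → ℕ → Set
RunAt s a t i = ∀ k → k < t → s (i + k) ≡ a

MaxRun : ∀ {q} → Seq q → Fin q → ℕ → Set
MaxRun s a t = (∃[ i ] RunAt s a t i) × (∀ i t' → RunAt s a t' i → t' ≤ t)

-- D(T) = S, i.e. s_i = t_{i+1} - t_i in Z_q
DEq : ∀ {q} → Seq q → Seq q → Set
DEq {q} t s = ∀ i → toℕ (t (suc i)) ≡ toℕ (t i) + toℕ (s i) [mod q ]

InDInv : ∀ {q} → Seq q → Seq q → Set
InDInv s t = Periodic t × DEq t s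

shift : ∀ {q} → ℕ → Seq q → Seq q
shift k t i = t (k + i)

infix 4 _≈_
_≈_ : ∀ {q} → Seq q → Seq q → Set
s ≈ t = ∀ i → s i ≡ t i

{-# OPTIONS --safe #-}
module Submission where

-- Let w = w_q(S). Every T ∈ D⁻¹(S) is a discrete antiderivative, T i ≡ T 0 + s₀ + ⋯ + s_{i-1},
-- so T is determined by T 0 and T (k m + i) ≡ T i + k w (mod q). As w has order q, the values
-- T i + j w (j < q) run through all of ℤ_q: the shifts of one antiderivative by j m are distinct
-- and exhaust D⁻¹(S), and T takes every value a on each coset i + mℤ. A period p of T is a period
-- of S, so p = k m, and T (k m) = T 0 forces k w ≡ 0, i.e. k ≥ q. Finally T is constant exactly
-- where S vanishes, so a maximal run 0ᵗ of S at i gives maximal runs aᵗ⁺¹ of T at i + j m.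

open import Defs
open import Level using (0ℓ)
open import Data.Nat using (ℕ; zero; suc; _+_; _*_; _∸_; _≤_; _<_; z≤n; s≤s; NonZero; >-nonZero; >-nonZero⁻¹)
open import Data.Nat.Properties
open import Data.Nat.DivMod using (_%_; _/_; _mod_; m≡m%n+[m/n]*n; [m+kn]%n≡m%n; m%n<n; m<n⇒m%n≡m)
open import Data.Nat.Divisibility using (_∣_; m%n≡0⇒n∣m)
open import Algebra.Properties.CommutativeSemigroup +-commutativeSemigroup using (interchange; xy∙z≈xz∙y)
open import Data.Fin using (Fin; toℕ; punchOut)
open import Data.Fin.Properties using (toℕ<n; toℕ-injective; toℕ-fromℕ<; any?; punchOut-injective; injective⇒≤)
  renaming (_≟_ to _≟ᶠ_)
open import Data.Product using (∃; ∃-syntax; _×_; _,_; proj₁; proj₂)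
open import Function using (_∘_)
open import Function.Definitions using (Injective)
open import Relation.Nullary using (¬_; yes; no; contradiction)
open import Relation.Binary.Bundles using (Setoid)
open import Relation.Binary.Definitions using (tri<; tri≈; tri>)
open import Relation.Binary.PropositionalEquality using (_≡_; _≢_; refl; sym; trans; cong; cong₂; subst; module ≡-Reasoning)
import Relation.Binary.Reasoning.Setoid as SetoidReasoning

module _ {q : ℕ} where

  mod-refl : ∀ {x} → x ≡ x [mod q ]
  mod-refl = 0 , 0 , refl

  ≡⇒mod : ∀ {x y} → x ≡ y → x ≡ y [mod q ]
  ≡⇒mod refl = mod-refl

  mod-sym : ∀ {x y} → x ≡ y [mod q ] → y ≡ x [mod q ]
  mod-sym (a , b , e) = b , a , sym e

  private
    +-*-distrib : ∀ x a c → x + (a + c) * q ≡ x + a * q + c * q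
    +-*-distrib x a c = trans (cong (x +_) (*-distribʳ-+ q a c)) (sym (+-assoc x _ _))

  mod-trans : ∀ {x y z} → x ≡ y [mod q ] → y ≡ z [mod q ] → x ≡ z [mod q ]
  mod-trans {x} {y} {z} (a , b , x≡y) (c , d , y≡z) = a + c , d + b , (begin
    x + (a + c) * q      ≡⟨ +-*-distrib x a c ⟩
    (x + a * q) + c * q  ≡⟨ cong (_+ c * q) x≡y ⟩
    (y + b * q) + c * q  ≡⟨ xy∙z≈xz∙y y _ _ ⟩
    (y + c * q) + b * q  ≡⟨ cong (_+ b * q) y≡z ⟩
    (z + d * q) + b * q  ≡⟨ +-*-distrib z d b ⟨
    z + (d + b) * q      ∎)
    where open ≡-Reasoning

  +-cong-mod : ∀ {x y u v} → x ≡ y [mod q ] → u ≡ v [mod q ] → x + u ≡ y + v [mod q ]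
  +-cong-mod {x} {y} {u} {v} (a , b , x≡y) (c , d , u≡v) = a + c , b + d , (begin
    x + u + (a + c) * q        ≡⟨ cong (x + u +_) (*-distribʳ-+ q a c) ⟩
    (x + u) + (a * q + c * q)  ≡⟨ interchange x u _ _ ⟩
    (x + a * q) + (u + c * q)  ≡⟨ cong₂ _+_ x≡y u≡v ⟩
    (y + b * q) + (v + d * q)  ≡⟨ interchange y _ v _ ⟩
    (y + v) + (b * q + d * q)  ≡⟨ cong (y + v +_) (*-distribʳ-+ q b d) ⟨
    y + v + (b + d) * q        ∎)
    where open ≡-Reasoning

  +-cancelˡ-mod : ∀ c {x y} → c + x ≡ c + y [mod q ] → x ≡ y [mod q ]
  +-cancelˡ-mod c {x} {y} (a , b , e) = a , b , +-cancelˡ-≡ c _ _ (begin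
    c + (x + a * q)  ≡⟨ +-assoc c x _ ⟨
    c + x + a * q    ≡⟨ e ⟩
    c + y + b * q    ≡⟨ +-assoc c y _ ⟩
    c + (y + b * q)  ∎)
    where open ≡-Reasoning

  +-multiple-mod : ∀ x k → x + k * q ≡ x [mod q ]
  +-multiple-mod x k = 0 , k , +-identityʳ (x + k * q)

mod-setoid : ℕ → Setoid 0ℓ 0ℓ
mod-setoid q = record
  { Carrier       = ℕ
  ; _≈_           = _≡_[mod q ]
  ; isEquivalence = record { refl = mod-refl ; sym = mod-sym ; trans = mod-trans }
  }

module mod-Reasoning (q : ℕ) = SetoidReasoning (mod-setoid q)

module _ {q : ℕ} .{{_ : NonZero q}} where

  mod⇒%≡ : ∀ {x y} → x ≡ y [mod q ] → x % q ≡ y % q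
  mod⇒%≡ {x} {y} (a , b , e) = begin
    x % q            ≡⟨ [m+kn]%n≡m%n x a q ⟨
    (x + a * q) % q  ≡⟨ cong (_% q) e ⟩
    (y + b * q) % q  ≡⟨ [m+kn]%n≡m%n y b q ⟩
    y % q            ∎
    where open ≡-Reasoning

  toℕ-mod : ∀ x → toℕ (x mod q) ≡ x [mod q ]
  toℕ-mod x = x / q , 0 , (begin
    toℕ (x mod q) + x / q * q  ≡⟨ cong (_+ x / q * q) (toℕ-fromℕ< (m%n<n x q)) ⟩
    x % q + x / q * q          ≡⟨ m≡m%n+[m/n]*n x q ⟨
    x                          ≡⟨ +-identityʳ x ⟨
    x + 0 * q                  ∎)
    where open ≡-Reasoning

  toℕ-injective-mod : ∀ {a b : Fin q} → toℕ a ≡ toℕ b [mod q ] → a ≡ b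
  toℕ-injective-mod {a} {b} a≡b = toℕ-injective (begin
    toℕ a      ≡⟨ m<n⇒m%n≡m (toℕ<n a) ⟨
    toℕ a % q  ≡⟨ mod⇒%≡ a≡b ⟩
    toℕ b % q  ≡⟨ m<n⇒m%n≡m (toℕ<n b) ⟩
    toℕ b      ∎)
    where open ≡-Reasoning

injective⇒surjective : ∀ {n} {f : Fin n → Fin n} → Injective _≡_ _≡_ f → ∀ y → ∃[ x ] f x ≡ y
injective⇒surjective {suc n} {f} f-inj y with any? (λ x → f x ≟ᶠ y)
... | yes hit  = hit
... | no  miss = contradiction (injective⇒≤ g-inj) 1+n≰n
  where
  y≢f : ∀ x → y ≢ f x
  y≢f x y≡fx = miss (x , sym y≡fx)

  g : Fin (suc n) → Fin n
  g x = punchOut (y≢f x)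

  g-inj : Injective _≡_ _≡_ g
  g-inj gx≡gx′ = f-inj (punchOut-injective (y≢f _) (y≢f _) gx≡gx′)

module _ {q W k : ℕ} (W-order : AddOrder q W k) where

  private
    multiples-distinct : ∀ {a b} → a < b → b < k → ¬ (a * W ≡ b * W [mod q ])
    multiples-distinct {a} {b} a<b b<k aW≡bW =
      <⇒≱ b<k (≤-trans (proj₂ (proj₂ W-order) (b ∸ a) (m<n⇒0<n∸m a<b) [b∸a]W≡0) (m∸n≤m b a))
      where
      open mod-Reasoning q
      [b∸a]W≡0 : (b ∸ a) * W ≡ 0 [mod q ]
      [b∸a]W≡0 = +-cancelˡ-mod (a * W) (begin
        a * W + (b ∸ a) * W  ≡⟨ *-distribʳ-+ W a (b ∸ a) ⟨
        (a + (b ∸ a)) * W    ≡⟨ cong (_* W) (m+[n∸m]≡n (<⇒≤ a<b)) ⟩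
        b * W                ≈⟨ aW≡bW ⟨
        a * W                ≡⟨ +-identityʳ (a * W) ⟨
        a * W + 0            ∎)

  multiples-injective : ∀ {a b} → a < k → b < k → a * W ≡ b * W [mod q ] → a ≡ b
  multiples-injective {a} {b} a<k b<k aW≡bW with <-cmp a b
  ... | tri< a<b _ _ = contradiction aW≡bW (multiples-distinct a<b b<k)
  ... | tri≈ _ a≡b _ = a≡b
  ... | tri> _ _ b<a = contradiction (mod-sym aW≡bW) (multiples-distinct b<a a<k)

module _ {q W : ℕ} .{{_ : NonZero q}} (W-order : AddOrder q W q) where

  private
    translate : ℕ → Fin q → Fin q
    translate x j = (x + toℕ j * W) mod q

    translate-injective : ∀ x → Injective _≡_ _≡_ (translate x)
    translate-injective x {i} {j} xi≡xj = toℕ-injective (multiples-injective W-order (toℕ<n i) (toℕ<n j)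
      (+-cancelˡ-mod x (begin
        x + toℕ i * W          ≈⟨ toℕ-mod _ ⟨
        toℕ (translate x i)    ≡⟨ cong toℕ xi≡xj ⟩
        toℕ (translate x j)    ≈⟨ toℕ-mod _ ⟩
        x + toℕ j * W          ∎)))
      where open mod-Reasoning q

  multiples-surjective : ∀ x y → ∃[ j ] x + toℕ j * W ≡ y [mod q ]
  multiples-surjective x y = let j , xj≡y = injective⇒surjective (translate-injective x) (y mod q) in
    j , (begin
      x + toℕ j * W        ≈⟨ toℕ-mod _ ⟨
      toℕ (translate x j)  ≡⟨ cong toℕ xj≡y ⟩
      toℕ (y mod q)        ≈⟨ toℕ-mod y ⟩
      y                    ∎)
    where open mod-Reasoning q

sumTo-cong : ∀ {f g} → (∀ i → f i ≡ g i) → ∀ n → sumTo f n ≡ sumTo g n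
sumTo-cong f≗g zero    = refl
sumTo-cong f≗g (suc n) = cong₂ _+_ (sumTo-cong f≗g n) (f≗g n)

sumTo-+ : ∀ f m n → sumTo f (m + n) ≡ sumTo f m + sumTo (λ i → f (m + i)) n
sumTo-+ f m zero    = trans (cong (sumTo f) (+-identityʳ m)) (sym (+-identityʳ _))
sumTo-+ f m (suc n) = begin
  sumTo f (m + suc n)                                ≡⟨ cong (sumTo f) (+-suc m n) ⟩
  sumTo f (m + n) + f (m + n)                        ≡⟨ cong (_+ f (m + n)) (sumTo-+ f m n) ⟩
  sumTo f m + sumTo (λ i → f (m + i)) n + f (m + n)  ≡⟨ +-assoc (sumTo f m) _ _ ⟩
  sumTo f m + sumTo (λ i → f (m + i)) (suc n)        ∎
  where open ≡-Reasoning

sumTo-periodic : ∀ {f m} → (∀ i → f (i + m) ≡ f i) →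
                 ∀ k n → sumTo f (k * m + n) ≡ k * sumTo f m + sumTo f n
sumTo-periodic f-per zero    n = refl
sumTo-periodic {f} {m} f-per (suc k) n = begin
  sumTo f ((m + k * m) + n)                        ≡⟨ cong (sumTo f) (+-assoc m (k * m) n) ⟩
  sumTo f (m + (k * m + n))                        ≡⟨ sumTo-+ f m (k * m + n) ⟩
  sumTo f m + sumTo (λ i → f (m + i)) (k * m + n)  ≡⟨ cong (sumTo f m +_) (sumTo-cong f[m+i]≡f[i] (k * m + n)) ⟩
  sumTo f m + sumTo f (k * m + n)                  ≡⟨ cong (sumTo f m +_) (sumTo-periodic f-per k n) ⟩
  sumTo f m + (k * sumTo f m + sumTo f n)          ≡⟨ +-assoc (sumTo f m) _ _ ⟨
  suc k * sumTo f m + sumTo f n                    ∎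
  where
  open ≡-Reasoning
  f[m+i]≡f[i] : ∀ i → f (m + i) ≡ f i
  f[m+i]≡f[i] i = trans (cong f (+-comm m i)) (f-per i)

periodic-multiple : ∀ {A : Set} {s : ℕ → A} {p} → (∀ i → s (i + p) ≡ s i) →
                    ∀ k i → s (k * p + i) ≡ s i
periodic-multiple s-per zero    i = refl
periodic-multiple {s = s} {p} s-per (suc k) i = begin
  s ((p + k * p) + i)  ≡⟨ cong s (trans (+-assoc p (k * p) i) (+-comm p _)) ⟩
  s ((k * p + i) + p)  ≡⟨ s-per (k * p + i) ⟩
  s (k * p + i)        ≡⟨ periodic-multiple s-per k i ⟩
  s i                  ∎
  where open ≡-Reasoning

RunAt-periodic : ∀ {q} {s : Seq q} {p a t i} → (∀ i → s (i + p) ≡ s i) →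
                 RunAt s a t i → ∀ k → RunAt s a t (k * p + i)
RunAt-periodic {s = s} {p} {a} {i = i} s-per s-run k j j<t = begin
  s (k * p + i + j)    ≡⟨ cong s (+-assoc (k * p) i j) ⟩
  s (k * p + (i + j))  ≡⟨ periodic-multiple s-per k (i + j) ⟩
  s (i + j)            ≡⟨ s-run j j<t ⟩
  a                    ∎
  where open ≡-Reasoning

least-period-divides : ∀ {q} {s : Seq q} {m p} → HasPeriod s m → IsPeriod s p → m ∣ p
least-period-divides {s = s} {m} {p} ((0<m , s-m) , m-least) (_ , s-p) = m%n≡0⇒n∣m p m p%m≡0
  where
  instance
    m≢0 : NonZero m
    m≢0 = >-nonZero 0<m

  s-p%m : ∀ i → s (i + p % m) ≡ s i
  s-p%m i = begin
    s (i + p % m)                ≡⟨ periodic-multiple s-m (p / m) (i + p % m) ⟨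
    s (p / m * m + (i + p % m))  ≡⟨ cong s (+-comm (p / m * m) _) ⟩
    s ((i + p % m) + p / m * m)  ≡⟨ cong s (+-assoc i (p % m) _) ⟩
    s (i + (p % m + p / m * m))  ≡⟨ cong (λ p′ → s (i + p′)) (m≡m%n+[m/n]*n p m) ⟨
    s (i + p)                    ≡⟨ s-p i ⟩
    s i                          ∎
    where open ≡-Reasoning

  p%m≡0 : p % m ≡ 0
  p%m≡0 = n≤0⇒n≡0 (≮⇒≥ λ 0<p%m → <⇒≱ (m%n<n p m) (m-least (p % m) (0<p%m , s-p%m)))

shift-IsPeriod : ∀ {q} {T : Seq q} {p} c → IsPeriod T p → IsPeriod (shift c T) p
shift-IsPeriod {T = T} {p} c (0<p , T-per) = 0<p , λ i → trans (cong T (sym (+-assoc c i p))) (T-per (c + i))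

antidifference : ∀ {q} .{{_ : NonZero q}} → Seq q → Seq q
antidifference {q} S i = sumTo (toℕ ∘ S) i mod q

module _ {q : ℕ} .{{_ : NonZero q}} {S : Seq q} where

  antidifference-DEq : DEq (antidifference S) S
  antidifference-DEq i = begin
    toℕ (sumTo (toℕ ∘ S) (suc i) mod q)       ≈⟨ toℕ-mod _ ⟩
    sumTo (toℕ ∘ S) i + toℕ (S i)             ≈⟨ +-cong-mod (toℕ-mod _) mod-refl ⟨
    toℕ (sumTo (toℕ ∘ S) i mod q) + toℕ (S i) ∎
    where open mod-Reasoning q

  DEq-sum : ∀ {T} → DEq T S → ∀ k → toℕ (T k) ≡ toℕ (T 0) + sumTo (toℕ ∘ S) k [mod q ]
  DEq-sum T-deq zero    = ≡⇒mod (sym (+-identityʳ _))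
  DEq-sum {T} T-deq (suc k) = begin
    toℕ (T (suc k))                            ≈⟨ T-deq k ⟩
    toℕ (T k) + toℕ (S k)                      ≈⟨ +-cong-mod (DEq-sum T-deq k) mod-refl ⟩
    toℕ (T 0) + sumTo (toℕ ∘ S) k + toℕ (S k)  ≡⟨ +-assoc (toℕ (T 0)) _ _ ⟩
    toℕ (T 0) + sumTo (toℕ ∘ S) (suc k)        ∎
    where open mod-Reasoning q

  DEq-period-step : ∀ {T m} → IsPeriod S m → DEq T S →
                    ∀ k i → toℕ (T (k * m + i)) ≡ toℕ (T i) + k * weight S m [mod q ]
  DEq-period-step {T} {m} (_ , S-per) T-deq k i = begin
    toℕ (T (k * m + i))                  ≈⟨ DEq-sum T-deq (k * m + i) ⟩
    toℕ (T 0) + sumTo σ (k * m + i)      ≡⟨ cong (toℕ (T 0) +_) (sumTo-periodic (cong toℕ ∘ S-per) k i) ⟩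
    toℕ (T 0) + (k * W + sumTo σ i)      ≡⟨ cong (toℕ (T 0) +_) (+-comm (k * W) _) ⟩
    toℕ (T 0) + (sumTo σ i + k * W)      ≡⟨ +-assoc (toℕ (T 0)) _ _ ⟨
    toℕ (T 0) + sumTo σ i + k * W        ≈⟨ +-cong-mod (DEq-sum T-deq i) mod-refl ⟨
    toℕ (T i) + k * W                    ∎
    where
    open mod-Reasoning q
    σ = toℕ ∘ S
    W = weight S m

  DEq-shift : ∀ {T c} → (∀ i → S (c + i) ≡ S i) → DEq T S → DEq (shift c T) S
  DEq-shift {T} {c} S-c T-deq i = begin
    toℕ (T (c + suc i))                ≡⟨ cong (toℕ ∘ T) (+-suc c i) ⟩
    toℕ (T (suc (c + i)))              ≈⟨ T-deq (c + i) ⟩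
    toℕ (T (c + i)) + toℕ (S (c + i))  ≡⟨ cong (λ s → toℕ (T (c + i)) + toℕ s) (S-c i) ⟩
    toℕ (T (c + i)) + toℕ (S i)        ∎
    where open mod-Reasoning q

  DEq-unique : ∀ {T T′} → DEq T S → DEq T′ S → T 0 ≡ T′ 0 → T ≈ T′
  DEq-unique T-deq T′-deq T0≡T′0 zero = T0≡T′0
  DEq-unique {T} {T′} T-deq T′-deq T0≡T′0 (suc i) = toℕ-injective-mod (begin
    toℕ (T (suc i))         ≈⟨ T-deq i ⟩
    toℕ (T i) + toℕ (S i)   ≡⟨ cong (λ x → toℕ x + toℕ (S i)) (DEq-unique T-deq T′-deq T0≡T′0 i) ⟩
    toℕ (T′ i) + toℕ (S i)  ≈⟨ T′-deq i ⟨
    toℕ (T′ (suc i))        ∎)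
    where open mod-Reasoning q

  DEq-IsPeriod⁻ : ∀ {T p} → DEq T S → IsPeriod T p → IsPeriod S p
  DEq-IsPeriod⁻ {T} {p} T-deq (0<p , T-per) = 0<p , λ i →
    toℕ-injective-mod (+-cancelˡ-mod (toℕ (T i)) (begin
      toℕ (T i) + toℕ (S (i + p))        ≡⟨ cong (λ x → toℕ x + toℕ (S (i + p))) (T-per i) ⟨
      toℕ (T (i + p)) + toℕ (S (i + p))  ≈⟨ T-deq (i + p) ⟨
      toℕ (T (suc i + p))                ≡⟨ cong toℕ (T-per (suc i)) ⟩
      toℕ (T (suc i))                    ≈⟨ T-deq i ⟩
      toℕ (T i) + toℕ (S i)              ∎))
    where open mod-Reasoning q

  DEq-IsPeriod : ∀ {T m} → IsPeriod S m → DEq T S → IsPeriod T (q * m)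
  DEq-IsPeriod {T} {m} S-period@(0<m , _) T-deq = >-nonZero⁻¹ (q * m) {{m*n≢0 q m}} , λ i →
    toℕ-injective-mod (begin
      toℕ (T (i + q * m))          ≡⟨ cong (toℕ ∘ T) (+-comm i (q * m)) ⟩
      toℕ (T (q * m + i))          ≈⟨ DEq-period-step S-period T-deq q i ⟩
      toℕ (T i) + q * weight S m   ≡⟨ cong (toℕ (T i) +_) (*-comm q _) ⟩
      toℕ (T i) + weight S m * q   ≈⟨ +-multiple-mod (toℕ (T i)) (weight S m) ⟩
      toℕ (T i)                    ∎)
    where
    open mod-Reasoning q
    instance
      m≢0 : NonZero m
      m≢0 = >-nonZero 0<m

  shifts-InDInv : ∀ {T m} → IsPeriod S m → DEq T S → ∀ k → InDInv S (shift (k * m) T)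
  shifts-InDInv {T} {m} S-period T-deq k =
    (q * m , shift-IsPeriod (k * m) (DEq-IsPeriod S-period T-deq)) ,
    DEq-shift (periodic-multiple (proj₂ S-period) k) T-deq

  DEq-HasPeriod : ∀ {T m} → HasPeriod S m → AddOrder q (weight S m) q → DEq T S → HasPeriod T (q * m)
  DEq-HasPeriod {T} {m} S-hasPeriod@(S-period , _) (_ , _ , q-least) T-deq = DEq-IsPeriod S-period T-deq , qm-least
    where
    qm-least : ∀ p → IsPeriod T p → q * m ≤ p
    qm-least p T-period@(0<p , T-per) = subst (q * m ≤_) (sym p≡km) (*-monoˡ-≤ m (q-least k 0<k kW≡0))
      where
      open mod-Reasoning q
      open _∣_ (least-period-divides S-hasPeriod (DEq-IsPeriod⁻ T-deq T-period))
        renaming (quotient to k; equality to p≡km)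

      0<k : 0 < k
      0<k = >-nonZero⁻¹ k {{m*n≢0⇒m≢0 k {{>-nonZero (subst (0 <_) p≡km 0<p)}}}}

      kW≡0 : k * weight S m ≡ 0 [mod q ]
      kW≡0 = +-cancelˡ-mod (toℕ (T 0)) (begin
        toℕ (T 0) + k * weight S m  ≈⟨ DEq-period-step S-period T-deq k 0 ⟨
        toℕ (T (k * m + 0))         ≡⟨ cong (toℕ ∘ T) (+-identityʳ (k * m)) ⟩
        toℕ (T (k * m))             ≡⟨ cong (toℕ ∘ T) p≡km ⟨
        toℕ (T p)                   ≡⟨ cong toℕ (T-per 0) ⟩
        toℕ (T 0)                   ≡⟨ +-identityʳ _ ⟨
        toℕ (T 0) + 0               ∎)

  module _ {z : Fin q} (z≡0 : toℕ z ≡ 0) {T : Seq q} (T-deq : DEq T S) where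

    DEq-flat : ∀ {i} → S i ≡ z → T (suc i) ≡ T i
    DEq-flat {i} Si≡z = toℕ-injective-mod (begin
      toℕ (T (suc i))        ≈⟨ T-deq i ⟩
      toℕ (T i) + toℕ (S i)  ≡⟨ cong (λ s → toℕ (T i) + toℕ s) Si≡z ⟩
      toℕ (T i) + toℕ z      ≡⟨ cong (toℕ (T i) +_) z≡0 ⟩
      toℕ (T i) + 0          ≡⟨ +-identityʳ _ ⟩
      toℕ (T i)              ∎)
      where open mod-Reasoning q

    DEq-flat⁻ : ∀ {i} → T (suc i) ≡ T i → S i ≡ z
    DEq-flat⁻ {i} T-flat = toℕ-injective-mod (+-cancelˡ-mod (toℕ (T i)) (begin
      toℕ (T i) + toℕ (S i)  ≈⟨ T-deq i ⟨
      toℕ (T (suc i))        ≡⟨ cong toℕ T-flat ⟩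
      toℕ (T i)              ≡⟨ +-identityʳ _ ⟨
      toℕ (T i) + 0          ≡⟨ cong (toℕ (T i) +_) z≡0 ⟨
      toℕ (T i) + toℕ z      ∎))
      where open mod-Reasoning q

    DEq-RunAt : ∀ {t i} → RunAt S z t i → RunAt T (T i) (suc t) i
    DEq-RunAt {i = i} S-run zero    _           = cong T (+-identityʳ i)
    DEq-RunAt {i = i} S-run (suc k) (s≤s k<t) = begin
      T (i + suc k)    ≡⟨ cong T (+-suc i k) ⟩
      T (suc (i + k))  ≡⟨ DEq-flat (S-run k k<t) ⟩
      T (i + k)        ≡⟨ DEq-RunAt S-run k (m<n⇒m<1+n k<t) ⟩
      T i              ∎
      where open ≡-Reasoning

    DEq-RunAt⁻ : ∀ {a t i} → RunAt T a (suc t) i → RunAt S z t i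
    DEq-RunAt⁻ {a} {i = i} T-run k k<t = DEq-flat⁻ (begin
      T (suc (i + k))  ≡⟨ cong T (+-suc i k) ⟨
      T (i + suc k)    ≡⟨ T-run (suc k) (s≤s k<t) ⟩
      a                ≡⟨ T-run k (m<n⇒m<1+n k<t) ⟨
      T (i + k)        ∎)
      where open ≡-Reasoning

  module _ {m : ℕ} (S-period : IsPeriod S m) (W-order : AddOrder q (weight S m) q)
           {T : Seq q} (T-deq : DEq T S) where

    DEq-attains : ∀ i a → ∃[ j ] T (toℕ j * m + i) ≡ a
    DEq-attains i a = let j , Ti+jW≡a = multiples-surjective W-order (toℕ (T i)) (toℕ a) in
      j , toℕ-injective-mod (mod-trans (DEq-period-step S-period T-deq (toℕ j) i) Ti+jW≡a)

    DEq-MaxRun : ∀ {z t} → toℕ z ≡ 0 → MaxRun S z t → ∀ a → MaxRun T a (suc t)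
    DEq-MaxRun {z} {t} z≡0 ((i , S-run) , t-max) a = (toℕ j * m + i , T-run) , suc-t-max
      where
      j = proj₁ (DEq-attains i a)

      T-run : RunAt T a (suc t) (toℕ j * m + i)
      T-run = subst (λ b → RunAt T b (suc t) (toℕ j * m + i)) (proj₂ (DEq-attains i a))
                (DEq-RunAt z≡0 T-deq (RunAt-periodic (proj₂ S-period) S-run (toℕ j)))

      suc-t-max : ∀ i′ t′ → RunAt T a t′ i′ → t′ ≤ suc t
      suc-t-max i′ zero     _     = z≤n
      suc-t-max i′ (suc t′) T-run′ = s≤s (t-max i′ t′ (DEq-RunAt⁻ z≡0 T-deq T-run′))

    shifts-distinct : ∀ (j j′ : Fin q) → shift (toℕ j * m) T ≈ shift (toℕ j′ * m) T → j ≡ j′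
    shifts-distinct j j′ shifts≈ = toℕ-injective (multiples-injective W-order (toℕ<n j) (toℕ<n j′)
      (+-cancelˡ-mod (toℕ (T 0)) (begin
        toℕ (T 0) + toℕ j * weight S m   ≈⟨ DEq-period-step S-period T-deq (toℕ j) 0 ⟨
        toℕ (T (toℕ j * m + 0))          ≡⟨ cong toℕ (shifts≈ 0) ⟩
        toℕ (T (toℕ j′ * m + 0))         ≈⟨ DEq-period-step S-period T-deq (toℕ j′) 0 ⟩
        toℕ (T 0) + toℕ j′ * weight S m  ∎)))
      where open mod-Reasoning q

    shifts-exhaustive : ∀ {T′} → DEq T′ S → ∃[ j ] T′ ≈ shift (toℕ j * m) T
    shifts-exhaustive {T′} T′-deq = let j , T[jm]≡T′0 = DEq-attains 0 (T′ 0) in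
      j , DEq-unique T′-deq (DEq-shift (periodic-multiple (proj₂ S-period) (toℕ j)) T-deq) (sym T[jm]≡T′0)

corollary1 : (q n m t : ℕ) → 2 ≤ q → 1 ≤ n → (S : Seq q) →
    HasPeriod S m → Orientable S m n → AddOrder q (weight S m) q →
    (z : Fin q) → toℕ z ≡ 0 → 0 < t → MaxRun S z t →
    (∃[ T ] ∃ λ (c : Fin q → ℕ) → (((j : Fin q) → InDInv S (shift (c j) T)) ×
    ((j j′ : Fin q) → shift (c j) T ≈ shift (c j′) T → j ≡ j′) ×
    ((T′ : Seq q) → InDInv S T′ → ∃[ j ] (T′ ≈ shift (c j) T))))
    × ((T : Seq q) → InDInv S T → HasPeriod T (q * m))
    × ((T : Seq q) → InDInv S T → (a : Fin q) → MaxRun T a (suc t))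
corollary1 q n m t 2≤q _ S S-hasPeriod@(S-period , _) _ W-order z z≡0 _ S-maxRun =
  ( antidifference S , (λ j → toℕ j * m)
  , (λ j → shifts-InDInv S-period antidifference-DEq (toℕ j))
  , shifts-distinct S-period W-order antidifference-DEq
  , (λ T′ (_ , T′-deq) → shifts-exhaustive S-period W-order antidifference-DEq T′-deq) )
  , (λ T (_ , T-deq) → DEq-HasPeriod S-hasPeriod W-order T-deq)
  , (λ T (_ , T-deq) → DEq-MaxRun S-period W-order T-deq z≡0 S-maxRun)
  where
  instance
    q≢0 : NonZero q
    q≢0 = >-nonZero (≤-trans (s≤s z≤n) 2≤q)
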